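{- Let $\diamond$ be one of the binary operations quotient ($\div$) or remainder ($\bmod$). Then there exist, for each positive integer $m$, a finite ground set $U_m$ with $|U_m|=O(m)$, a total order $<_m$ on $U_m$, and families $\mathcal{F}_m,\mathcal{G}_m$ of subsets of $U_m$ such that $Z_{<_m}(\mathcal{F}_m)+Z_{<_m}(\mathcal{G}_m)=O(m^3)$ and $Z_{<_m}(\mathcal{F}_m\diamond\mathcal{G}_m)=\Omega(2^{m/5}/\mathrm{poly}(m))$, i.e. $Z_{<_m}(\mathcal{F}_m\diamond\mathcal{G}_m)\ge 2^{m/5}/p(m)$ for some polynomial $p$ and all sufficiently large $m$.
   Context: A family of sets is a set of subsets of a finite ground set $U$. Join: $\mathcal{F}\sqcup\mathcal{G}=\{F\cup G\mid F\in\mathcal{F},G\in\mathcal{G}\}$. Quotient: $\mathcal{F}\div\mathcal{G}=\{S\mid \forall G\in\mathcal{G}: S\cup G\in\mathcal{F}\wedge S\cap G=\emptyset\}$. Remainder: $\mathcal{F}\bmod\mathcal{G}=\mathcal{F}\setminus(\mathcal{G}\sqcup(\mathcal{F}\div\mathcal{G}))$. A zero-suppressed binary decision diagram (ZDD) with respect to a total order $<$ on $U$ is a rooted DAG with two terminal nodes $\top,\bot$ and internal nodes $\mathtt{n}$, each with a label $\mathsf{lb}(\mathtt{n})\in U$ and children $\mathsf{lo}(\mathtt{n}),\mathsf{hi}(\mathtt{n})$, labels strictly increasing along arcs. A node represents: $\{\emptyset\}$ if $\top$, $\emptyset$ if $\bot$, and $\mathcal{F}_{\mathsf{lo}(\mathtt{n})}\cup\{\{\mathsf{lb}(\mathtt{n})\}\cup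 S\mid S\in\mathcal{F}_{\mathsf{hi}(\mathtt{n})}\}$ otherwise; the ZDD represents the family of its root. The reduced ZDD (obtained by merging nodes with identical label and children and deleting nodes whose hi-child is $\bot$) is the unique smallest ZDD for the family and order; $Z_<(\mathcal{F})$ is its number of nodes. Asymptotics are as $m\to\infty$. -}

module Defs where

open import Data.Nat using (ℕ; _+_; _*_; _^_; _≤_)
open import Data.Fin as Fin using (Fin)
open import Data.Fin.Subset using (Subset; _∪_; _∩_; ⁅_⁆) renaming (⊥ to ∅)
open import Data.Product using (Σ; ∃; ∃₂; _×_; _,_)
open import Relation.Nullary using (¬_)
open import Relation.Binary.PropositionalEquality using (_≡_)

-- Ground set U = Fin n, ordered by the standard order on Fin n.
-- A family of sets over U is a predicate on subsets of U.
Fam : ℕ → Set₁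
Fam n = Subset n → Set

module _ {n : ℕ} where

  _⊔_ : Fam n → Fam n → Fam n
  (F ⊔ G) S = ∃₂ λ A B → F A × G B × S ≡ A ∪ B

  _÷_ : Fam n → Fam n → Fam n
  (F ÷ G) S = ∀ B → G B → F (S ∪ B) × (S ∩ B ≡ ∅)

  _mod_ : Fam n → Fam n → Fam n
  (F mod G) S = F S × ¬ ((G ⊔ (F ÷ G)) S)

data Target (N : ℕ) : Set where
  top : Target N
  bot : Target N
  node : Fin N → Target N

record ZDD (n : ℕ) : Set where
  field
    N    : ℕ
    lb   : Fin N → Fin n
    lo   : Fin N → Target N
    hi   : Fin N → Target N
    root : Target N
    lo-ordered : ∀ i j → lo i ≡ node j → lb i Fin.< lb j
    hi-ordered : ∀ i j → hi i ≡ node j → lb i Fin.< lb j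

-- Number of nodes: internal nodes plus the two terminal nodes.
size : ∀ {n} → ZDD n → ℕ
size D = ZDD.N D + 2

data Mem {n : ℕ} (D : ZDD n) : Target (ZDD.N D) → Subset n → Set where
  mem-top : Mem D top ∅
  mem-lo  : ∀ i S → Mem D (ZDD.lo D i) S → Mem D (node i) S
  mem-hi  : ∀ i S → Mem D (ZDD.hi D i) S → Mem D (node i) (⁅ ZDD.lb D i ⁆ ∪ S)

Represents : ∀ {n} → ZDD n → Fam n → Set
Represents D F = ∀ S → (Mem D (ZDD.root D) S → F S) × (F S → Mem D (ZDD.root D) S)

data Op : Set where
  quot rem : Op

apply : ∀ {n} → Op → Fam n → Fam n → Fam n
apply quot F G = F ÷ G
apply rem  F G = F mod G

-- Order the ground set as z₀ … z_m, x₀ … x_{m-1}, y₀ … y_{m-1}, write its subsets as z ++ x ++ y,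
-- and let F = ⋃ᵢ {zᵢ} ⊔ Tᵢ and G = {{z₀}, …, {z_m}}, where T₀ contains every x ++ y and T_{i+1}
-- those with xᵢ = yᵢ. Then F ÷ G = {x ++ x}, while F mod G contains {z₀} ∪ (x ++ y) exactly when
-- x ≠ y. Each Tᵢ compares a single pair of coordinates, so F and G have ZDDs with O(m³) nodes,
-- built bottom-up one level at a time with one node per constraint "yᵢ = b" or "xⱼ = yᵢ".
-- Conversely, in a ZDD for F ÷ G or F mod G, reading the z's and then x leads to a node whose
-- family determines x, so there are at least 2^m nodes.

module Submission where

open import Defs
open import Data.Nat using (ℕ; zero; suc; _+_; _*_; _^_; _≤_; _<_; z≤n; s≤s; s≤s⁻¹)
import Data.Nat.Properties as ℕ
open import Data.Nat.Tactic.RingSolver using (solve-∀)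
open import Data.Fin as Fin using (Fin; zero; suc; toℕ; _↑ˡ_; _↑ʳ_; splitAt; combine; remQuot)
import Data.Fin.Properties as FinP
open import Data.Fin.Subset using (Subset; _∪_; _∩_; ⁅_⁆; _∈_) renaming (⊥ to ∅)
open import Data.Fin.Subset.Properties
  using ( ∪-identityˡ; ∪-identityʳ; ∪-comm; ∩-zeroˡ; ∩-zeroʳ; x∈p∩q⁺; x∈⁅x⁆; x∈⁅y⁆⇒x≡y; x∈p∪q⁺; x∈p∪q⁻
        ; ∉⊥; ⊆-antisym; _∈?_; Empty-unique)
open import Data.Vec as Vec using (Vec; []; _∷_; _++_; lookup; tabulate; take; drop; _[_]≔_; here; there)
open import Data.Vec.Properties
  using ( ≡-dec; lookup∘tabulate; tabulate∘lookup; tabulate-cong; zipWith-++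
        ; ++-injective; ++-injectiveˡ; ++-injectiveʳ; take++drop≡id)
open import Data.Bool as Bool using (Bool; true; false)
open import Relation.Nullary using (¬_; Dec; yes; no)
open import Data.Product using (Σ; ∃; ∃₂; _×_; _,_; proj₁; proj₂; uncurry)
open import Data.Sum using (_⊎_; inj₁; inj₂; [_,_])
open import Function using (_∘_)
open import Data.Empty using (⊥; ⊥-elim)
open import Data.Unit using (⊤; tt)
open import Function.Bundles using (_⇔_; mk⇔; Equivalence; Inverse; Injection)
open import Function.Properties.Inverse using (↔⇒↣)
import Function.Properties.Equivalence as ⇔
open import Relation.Binary.PropositionalEquality hiding ([_])

open Equivalence using (to; from)

noSets allSets onlyEmpty : ∀ {n} → Fam n
noSets _ = ⊥
allSets _ = ⊤
onlyEmpty S = S ≡ ∅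

-- The family of a node labelled 0 whose children represent F₀ and F₁.
branch : ∀ {n} → Fam n → Fam n → Fam (suc n)
branch F₀ F₁ (false ∷ S) = F₀ S
branch F₀ F₁ (true ∷ S) = F₁ S

RepresentsAt : ∀ {n} (D : ZDD n) → Target (ZDD.N D) → Fam n → Set
RepresentsAt D t F = ∀ S → Mem D t S ⇔ F S

module _ {n : ℕ} {D : ZDD n} where

  top-represents : RepresentsAt D top onlyEmpty
  top-represents S = mk⇔ (λ { mem-top → refl }) (λ { refl → mem-top })

  bot-represents : RepresentsAt D bot noSets
  bot-represents S = mk⇔ (λ ()) (λ ())

  RepresentsAt-resp : ∀ {t F G} → (∀ S → F S ⇔ G S) → RepresentsAt D t F → RepresentsAt D t G
  RepresentsAt-resp F⇔G rep S = ⇔.trans (rep S) (F⇔G S)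

Represents⇒RepresentsAt : ∀ {n} {D : ZDD n} {H} → Represents D H → RepresentsAt D (ZDD.root D) H
Represents⇒RepresentsAt rep S = mk⇔ (proj₁ (rep S)) (proj₂ (rep S))

emptyZDD : ∀ n → ZDD n
emptyZDD n = record { N = 0 ; lb = λ () ; lo = λ () ; hi = λ () ; root = top
                    ; lo-ordered = λ () ; hi-ordered = λ () }

rerooted : ∀ {n} (D : ZDD n) → Target (ZDD.N D) → ZDD n
rerooted D t = record D { root = t }

module _ {n : ℕ} (D : ZDD n) (r : Target (ZDD.N D)) where

  Mem-rerooted⁺ : ∀ {t S} → Mem D t S → Mem (rerooted D r) t S
  Mem-rerooted⁺ mem-top = mem-top
  Mem-rerooted⁺ (mem-lo i S p) = mem-lo i S (Mem-rerooted⁺ p)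
  Mem-rerooted⁺ (mem-hi i S p) = mem-hi i S (Mem-rerooted⁺ p)

  Mem-rerooted⁻ : ∀ {t S} → Mem (rerooted D r) t S → Mem D t S
  Mem-rerooted⁻ mem-top = mem-top
  Mem-rerooted⁻ (mem-lo i S p) = mem-lo i S (Mem-rerooted⁻ p)
  Mem-rerooted⁻ (mem-hi i S p) = mem-hi i S (Mem-rerooted⁻ p)

  rerooted-represents : ∀ {F} → RepresentsAt D r F → Represents (rerooted D r) F
  rerooted-represents rep S =
    (λ p → to (rep S) (Mem-rerooted⁻ p)) , (λ p → Mem-rerooted⁺ (from (rep S) p))

module _ {n : ℕ} (D : ZDD n) where
  open ZDD D

  mem-lo′ : ∀ {i t S} → lo i ≡ t → Mem D t S → Mem D (node i) S
  mem-lo′ refl = mem-lo _ _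

  mem-hi′ : ∀ {i t ℓ S} → hi i ≡ t → lb i ≡ ℓ → Mem D t S → Mem D (node i) (⁅ ℓ ⁆ ∪ S)
  mem-hi′ refl refl = mem-hi _ _

-- Building ZDDs level by level

-- Adds w nodes labelled 0 with the given children on top of D, whose labels are shifted up by one.
module Prepend {n : ℕ} (D : ZDD n) (w : ℕ) (lo₀ hi₀ : Fin w → Target (ZDD.N D)) where
  open ZDD D

  lift : Target N → Target (w + N)
  lift top = top
  lift bot = bot
  lift (node i) = node (w ↑ʳ i)

  new : Fin w → Target (w + N)
  new k = node (k ↑ˡ N)

  private
    lbˢ : Fin w ⊎ Fin N → Fin (suc n)
    lbˢ (inj₁ _) = zero
    lbˢ (inj₂ i) = suc (lb i)

    lb′ : Fin (w + N) → Fin (suc n)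
    lb′ x = lbˢ (splitAt w x)

    child : (Fin w → Target N) → (Fin N → Target N) → Fin (w + N) → Target (w + N)
    child c₀ c x = [ lift ∘ c₀ , lift ∘ c ] (splitAt w x)

    lb′-lift : ∀ i → lb′ (w ↑ʳ i) ≡ suc (lb i)
    lb′-lift i rewrite FinP.splitAt-↑ʳ w N i = refl

    lb′-new : ∀ k → lb′ (k ↑ˡ N) ≡ zero
    lb′-new k rewrite FinP.splitAt-↑ˡ w k N = refl

    child-lift : ∀ c₀ c i → child c₀ c (w ↑ʳ i) ≡ lift (c i)
    child-lift c₀ c i rewrite FinP.splitAt-↑ʳ w N i = refl

    child-new : ∀ c₀ c k → child c₀ c (k ↑ˡ N) ≡ lift (c₀ k)
    child-new c₀ c k rewrite FinP.splitAt-↑ˡ w k N = refl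

    lift-node⁻ : ∀ t {j} → lift t ≡ node j → ∃ λ i → t ≡ node i × j ≡ w ↑ʳ i
    lift-node⁻ (node i) refl = i , refl , refl

    lift-labelled-above : ∀ t {ℓ j} → (∀ i → t ≡ node i → ℓ ≤ toℕ (lb i)) →
                          lift t ≡ node j → suc ℓ ≤ toℕ (lb′ j)
    lift-labelled-above t above e with lift-node⁻ t e
    ... | i , t≡i , refl rewrite lb′-lift i = s≤s (above i t≡i)

    child-ordered : ∀ c₀ c → (∀ i j → c i ≡ node j → lb i Fin.< lb j) →
                    ∀ x j → child c₀ c x ≡ node j → lb′ x Fin.< lb′ j
    child-ordered c₀ c ordered x j e with splitAt w x
    ... | inj₁ k = lift-labelled-above (c₀ k) (λ _ _ → z≤n) e
    ... | inj₂ i = lift-labelled-above (c i) (ordered i) e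

  zdd : ZDD (suc n)
  zdd = record
    { N = w + N ; lb = lb′ ; lo = child lo₀ lo ; hi = child hi₀ hi ; root = bot
    ; lo-ordered = child-ordered lo₀ lo lo-ordered ; hi-ordered = child-ordered hi₀ hi hi-ordered }

  Mem-lift⁺ : ∀ {t S} → Mem D t S → Mem zdd (lift t) (false ∷ S)
  Mem-lift⁺ mem-top = mem-top
  Mem-lift⁺ (mem-lo i S p) = mem-lo′ zdd (child-lift lo₀ lo i) (Mem-lift⁺ p)
  Mem-lift⁺ (mem-hi i S p) = mem-hi′ zdd (child-lift hi₀ hi i) (lb′-lift i) (Mem-lift⁺ p)

  Mem-lift⁻ : ∀ {t′ T} → Mem zdd t′ T → ∀ t → t′ ≡ lift t → ∃ λ S → T ≡ false ∷ S × Mem D t S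
  Mem-lift⁻ mem-top top refl = ∅ , refl , mem-top
  Mem-lift⁻ (mem-lo _ _ p) (node i) refl with Mem-lift⁻ p (lo i) (child-lift lo₀ lo i)
  ... | S , refl , q = S , refl , mem-lo i S q
  Mem-lift⁻ (mem-hi _ _ p) (node i) refl with Mem-lift⁻ p (hi i) (child-lift hi₀ hi i)
  ... | S , refl , q = ⁅ lb i ⁆ ∪ S , cong (λ ℓ → ⁅ ℓ ⁆ ∪ (false ∷ S)) (lb′-lift i) , mem-hi i S q

  Mem-new⁻ : ∀ k {t′ T} → Mem zdd t′ T → t′ ≡ new k →
             (∃ λ S → T ≡ false ∷ S × Mem D (lo₀ k) S) ⊎ (∃ λ S → T ≡ true ∷ S × Mem D (hi₀ k) S)
  Mem-new⁻ k (mem-lo _ _ p) refl = inj₁ (Mem-lift⁻ p (lo₀ k) (child-new lo₀ lo k))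
  Mem-new⁻ k (mem-hi _ _ p) refl with Mem-lift⁻ p (hi₀ k) (child-new hi₀ hi k)
  ... | S , refl , q = inj₂ (S , trans (cong (λ ℓ → ⁅ ℓ ⁆ ∪ (false ∷ S)) (lb′-new k))
                                       (cong (true ∷_) (∪-identityˡ S)) , q)

  lift-represents : ∀ {t F} → RepresentsAt D t F → RepresentsAt zdd (lift t) (branch F noSets)
  lift-represents {t} rep (b ∷ S) = mk⇔ (sound ∘ λ p → Mem-lift⁻ p t refl) (complete b)
    where
      sound : (∃ λ S′ → b ∷ S ≡ false ∷ S′ × Mem D t S′) → branch _ noSets (b ∷ S)
      sound (S′ , refl , p) = to (rep S′) p
      complete : ∀ b → branch _ noSets (b ∷ S) → Mem zdd (lift t) (b ∷ S)
      complete false p = Mem-lift⁺ (from (rep S) p)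
      complete true ()

  new-represents : ∀ k {F₀ F₁} → RepresentsAt D (lo₀ k) F₀ → RepresentsAt D (hi₀ k) F₁ →
                   RepresentsAt zdd (new k) (branch F₀ F₁)
  new-represents k {F₀} {F₁} rep₀ rep₁ (b ∷ S) = mk⇔ (sound ∘ λ p → Mem-new⁻ k p refl) (complete b)
    where
      sound : _ → branch F₀ F₁ (b ∷ S)
      sound (inj₁ (S′ , refl , p)) = to (rep₀ S′) p
      sound (inj₂ (S′ , refl , p)) = to (rep₁ S′) p
      complete : ∀ b → branch F₀ F₁ (b ∷ S) → Mem zdd (new k) (b ∷ S)
      complete false p = mem-lo′ zdd (child-new lo₀ lo k) (Mem-lift⁺ (from (rep₀ S) p))
      complete true p = subst (Mem zdd (new k)) (cong (true ∷_) (∪-identityˡ S))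
        (mem-hi′ zdd (child-new hi₀ hi k) (lb′-new k) (Mem-lift⁺ (from (rep₁ S) p)))

record Shared (n : ℕ) (Q : Set) (F : Q → Fam n) : Set where
  field
    zdd : ZDD n
    target : Q → Target (ZDD.N zdd)
    represents : ∀ q → RepresentsAt zdd (target q) (F q)

-- A level of new nodes, one for each query of Q′ (coded in Fin width), whose
-- children are the nodes of the queries lo q and hi q one level down.
record Layer {n : ℕ} {Q : Set} (F : Q → Fam n) (Q′ : Set) (F′ : Q′ → Fam (suc n)) : Set where
  field
    width : ℕ
    code : Q′ → Fin width
    decode : Fin width → Q′
    decode-code : ∀ q → decode (code q) ≡ q
    lo hi : Q′ → Q
    cofactors : ∀ q S → branch (F (lo q)) (F (hi q)) S ⇔ F′ q S

module _ {n : ℕ} {Q Q′ : Set} {F : Q → Fam n} {F′ : Q′ → Fam (suc n)} (L : Layer F Q′ F′) where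
  open Layer L

  extend : Shared n Q F → Shared (suc n) Q′ F′
  extend B = record
    { zdd = P.zdd
    ; target = P.new ∘ code
    ; represents = λ q → RepresentsAt-resp (cofactors q)
        (P.new-represents (code q) (child-represents lo q) (child-represents hi q))
    }
    where
      open Shared B
      module P = Prepend zdd width (target ∘ lo ∘ decode) (target ∘ hi ∘ decode)
      child-represents : (c : Q′ → Q) (q : Q′) → RepresentsAt zdd (target (c (decode (code q)))) (F (c q))
      child-represents c q rewrite decode-code q = represents (c q)

-- Constraints on a set x ++ y, where x has s and y has m coordinates.
data Query (m s : ℕ) : Set where
  none all : Query m s
  bit : Fin m → Bool → Query m s
  eq : Fin s → Fin m → Query m s

⟦_⟧ : ∀ {m s} → Query m s → Fam (s + m)
⟦ none ⟧ = noSets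
⟦ all ⟧ = allSets
⟦_⟧ {s = s} (bit i b) v = lookup (drop s v) i ≡ b
⟦_⟧ {s = s} (eq j i) v = lookup (drop s v) i ≡ lookup (take s v) j

∣Query∣ : ℕ → ℕ → ℕ
∣Query∣ m s = 2 + (m + m + s * m)

∣Query∣-mono : ∀ {m m′ s s′} → m ≤ m′ → s ≤ s′ → ∣Query∣ m s ≤ ∣Query∣ m′ s′
∣Query∣-mono m≤m′ s≤s′ = ℕ.+-monoʳ-≤ 2 (ℕ.+-mono-≤ (ℕ.+-mono-≤ m≤m′ m≤m′) (ℕ.*-mono-≤ s≤s′ m≤m′))

module _ {m s : ℕ} where

  code : Query m s → Fin (∣Query∣ m s)
  code none = zero
  code all = suc zero
  code (bit i false) = suc (suc ((i ↑ˡ m) ↑ˡ s * m))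
  code (bit i true) = suc (suc ((m ↑ʳ i) ↑ˡ s * m))
  code (eq j i) = suc (suc ((m + m) ↑ʳ combine j i))

  decode-bit : Fin m ⊎ Fin m → Query m s
  decode-bit (inj₁ i) = bit i false
  decode-bit (inj₂ i) = bit i true

  decode-bit-eq : Fin (m + m) ⊎ Fin (s * m) → Query m s
  decode-bit-eq (inj₁ k) = decode-bit (splitAt m k)
  decode-bit-eq (inj₂ k) = uncurry eq (remQuot m k)

  decode : Fin (∣Query∣ m s) → Query m s
  decode zero = none
  decode (suc zero) = all
  decode (suc (suc k)) = decode-bit-eq (splitAt (m + m) k)

  decode-code : ∀ q → decode (code q) ≡ q
  decode-code none = refl
  decode-code all = refl
  decode-code (bit i false)
    rewrite FinP.splitAt-↑ˡ (m + m) (i ↑ˡ m) (s * m) | FinP.splitAt-↑ˡ m i m = refl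
  decode-code (bit i true)
    rewrite FinP.splitAt-↑ˡ (m + m) (m ↑ʳ i) (s * m) | FinP.splitAt-↑ʳ m m i = refl
  decode-code (eq j i)
    rewrite FinP.splitAt-↑ʳ (m + m) (s * m) (combine j i) = cong (uncurry eq) (FinP.remQuot-combine j i)

y-layer : ∀ r → Layer (⟦_⟧ {r} {0}) (Query (suc r) 0) ⟦_⟧
y-layer r = record { width = ∣Query∣ (suc r) 0 ; code = code ; decode = decode ; decode-code = decode-code
                   ; lo = lo ; hi = hi ; cofactors = cofactors }
  where
    lo hi : Query (suc r) 0 → Query r 0
    lo none = none
    lo all = all
    lo (bit zero false) = all
    lo (bit zero true) = none
    lo (bit (suc i) b) = bit i b
    hi none = none
    hi all = all
    hi (bit zero false) = none
    hi (bit zero true) = all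
    hi (bit (suc i) b) = bit i b

    cofactors : ∀ q S → branch ⟦ lo q ⟧ ⟦ hi q ⟧ S ⇔ ⟦ q ⟧ S
    cofactors none (false ∷ S) = ⇔.refl
    cofactors none (true ∷ S) = ⇔.refl
    cofactors all (false ∷ S) = ⇔.refl
    cofactors all (true ∷ S) = ⇔.refl
    cofactors (bit zero false) (false ∷ S) = mk⇔ (λ _ → refl) (λ _ → tt)
    cofactors (bit zero false) (true ∷ S) = mk⇔ (λ ()) (λ ())
    cofactors (bit zero true) (false ∷ S) = mk⇔ (λ ()) (λ ())
    cofactors (bit zero true) (true ∷ S) = mk⇔ (λ _ → refl) (λ _ → tt)
    cofactors (bit (suc i) b) (false ∷ S) = ⇔.refl
    cofactors (bit (suc i) b) (true ∷ S) = ⇔.refl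

x-layer : ∀ m s → Layer (⟦_⟧ {m} {s}) (Query m (suc s)) ⟦_⟧
x-layer m s = record { width = ∣Query∣ m (suc s) ; code = code ; decode = decode ; decode-code = decode-code
                     ; lo = lo ; hi = hi ; cofactors = cofactors }
  where
    lo hi : Query m (suc s) → Query m s
    lo none = none
    lo all = all
    lo (bit i b) = bit i b
    lo (eq zero i) = bit i false
    lo (eq (suc j) i) = eq j i
    hi none = none
    hi all = all
    hi (bit i b) = bit i b
    hi (eq zero i) = bit i true
    hi (eq (suc j) i) = eq j i

    cofactors : ∀ q S → branch ⟦ lo q ⟧ ⟦ hi q ⟧ S ⇔ ⟦ q ⟧ S
    cofactors none (false ∷ S) = ⇔.refl
    cofactors none (true ∷ S) = ⇔.refl
    cofactors all (false ∷ S) = ⇔.refl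
    cofactors all (true ∷ S) = ⇔.refl
    cofactors (bit i b) (false ∷ S) = ⇔.refl
    cofactors (bit i b) (true ∷ S) = ⇔.refl
    cofactors (eq zero i) (false ∷ S) = ⇔.refl
    cofactors (eq zero i) (true ∷ S) = ⇔.refl
    cofactors (eq (suc j) i) (false ∷ S) = ⇔.refl
    cofactors (eq (suc j) i) (true ∷ S) = ⇔.refl

y-stage : ∀ r → Shared r (Query r 0) ⟦_⟧
y-stage zero = record { zdd = emptyZDD 0 ; target = target ; represents = represents }
  where
    target : Query 0 0 → Target 0
    target all = top
    target _ = bot
    represents : ∀ q → RepresentsAt (emptyZDD 0) (target q) ⟦ q ⟧
    represents none = bot-represents
    represents all = RepresentsAt-resp (λ { [] → mk⇔ (λ _ → tt) (λ _ → refl) }) top-represents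
y-stage (suc r) = extend (y-layer r) (y-stage r)

x-stage : ∀ m s → Shared (s + m) (Query m s) ⟦_⟧
x-stage m zero = y-stage m
x-stage m (suc s) = extend (x-layer m s) (x-stage m s)

nodes : ∀ {n Q F} → Shared n Q F → ℕ
nodes B = ZDD.N (Shared.zdd B)

y-stage-nodes : ∀ {m} r → r ≤ m → nodes (y-stage r) ≤ r * ∣Query∣ m m
y-stage-nodes zero _ = z≤n
y-stage-nodes {m} (suc r) r<m = ℕ.+-mono-≤ (∣Query∣-mono {s′ = m} r<m z≤n) (y-stage-nodes r (ℕ.<⇒≤ r<m))

x-stage-nodes : ∀ m s → s ≤ m → nodes (x-stage m s) ≤ (s + m) * ∣Query∣ m m
x-stage-nodes m zero _ = y-stage-nodes {m} m ℕ.≤-refl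
x-stage-nodes m (suc s) s<m = ℕ.+-mono-≤ (∣Query∣-mono ℕ.≤-refl s<m) (x-stage-nodes m s (ℕ.<⇒≤ s<m))

-- Sets ∅ ++ S (with t leading zeros) for S ∈ F.
zeros : ∀ {r} t → Fam r → Fam (t + r)
zeros zero F = F
zeros (suc t) F = branch (zeros t F) noSets

-- The family ⋃ᵢ {zᵢ} ⊔ T i over the ground set z₀ … z_{t-1} followed by that of the T i.
chain : ∀ {r} t → (Fin t → Fam r) → Fam (t + r)
chain zero T = noSets
chain (suc t) T = branch (chain t (T ∘ suc)) (zeros t (T zero))

module _ {r : ℕ} (D : ZDD r) where

  record ChainZDD (t : ℕ) (T : Fin t → Fam r) : Set₁ where
    field
      zdd : ZDD (t + r)
      root : Target (ZDD.N zdd)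
      root-represents : RepresentsAt zdd root (chain t T)
      lift : Target (ZDD.N D) → Target (ZDD.N zdd)
      lift-represents : ∀ {x F} → RepresentsAt D x F → RepresentsAt zdd (lift x) (zeros t F)
      nodes≡ : ZDD.N zdd ≡ t + ZDD.N D

  chainZDD : ∀ t {T} (targets : Fin t → Target (ZDD.N D)) → (∀ i → RepresentsAt D (targets i) (T i)) →
             ChainZDD t T
  chainZDD zero targets _ = record
    { zdd = D ; root = bot ; root-represents = bot-represents
    ; lift = λ x → x ; lift-represents = λ rep → rep ; nodes≡ = refl }
  chainZDD (suc t) targets reps = record
    { zdd = P.zdd ; root = P.new zero
    ; root-represents = P.new-represents zero C.root-represents (C.lift-represents (reps zero))
    ; lift = P.lift ∘ C.lift ; lift-represents = P.lift-represents ∘ C.lift-represents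
    ; nodes≡ = cong suc C.nodes≡ }
    where
      module C = ChainZDD (chainZDD t (targets ∘ suc) (reps ∘ suc))
      module P = Prepend C.zdd 1 (λ _ → C.root) (λ _ → C.lift (targets zero))

zeros-∅-++ : ∀ {r} t (F : Fam r) v → zeros t F (∅ ++ v) ⇔ F v
zeros-∅-++ zero F v = ⇔.refl
zeros-∅-++ (suc t) F v = zeros-∅-++ t F v

zeros⁻ : ∀ {r} t (F : Fam r) S → zeros t F S → ∃ λ v → S ≡ ∅ ++ v × F v
zeros⁻ zero F S p = S , refl , p
zeros⁻ (suc t) F (false ∷ S) p with zeros⁻ t F S p
... | v , refl , q = v , refl , q

chain-⁅⁆-++ : ∀ {r} t (T : Fin t → Fam r) i v → chain t T (⁅ i ⁆ ++ v) ⇔ T i v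
chain-⁅⁆-++ (suc t) T zero v = zeros-∅-++ t (T zero) v
chain-⁅⁆-++ (suc t) T (suc i) v = chain-⁅⁆-++ t (T ∘ suc) i v

chain⁻ : ∀ {r} t (T : Fin t → Fam r) S → chain t T S → ∃₂ λ i v → S ≡ ⁅ i ⁆ ++ v × T i v
chain⁻ (suc t) T (true ∷ S) p with zeros⁻ t (T zero) S p
... | v , refl , q = zero , v , refl , q
chain⁻ (suc t) T (false ∷ S) p with chain⁻ t (T ∘ suc) S p
... | i , v , refl , q = suc i , v , refl , q

∅-++-∅ : ∀ a {b} → ∅ {a} ++ ∅ {b} ≡ ∅
∅-++-∅ zero = refl
∅-++-∅ (suc a) = cong (false ∷_) (∅-++-∅ a)

take-drop-++ : ∀ {A : Set} {a b} (x : Vec A a) (y : Vec A b) → take a (x ++ y) ≡ x × drop a (x ++ y) ≡ y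
take-drop-++ {a = a} x y = ++-injective (take a (x ++ y)) x (take++drop≡id a (x ++ y))

-- Residual families

∪-cancelˡ-⁅⁆ : ∀ {n} {a : Fin n} {S S′ : Subset n} → ¬ a ∈ S → ¬ a ∈ S′ → ⁅ a ⁆ ∪ S ≡ ⁅ a ⁆ ∪ S′ → S ≡ S′
∪-cancelˡ-⁅⁆ {a = a} {S} {S′} a∉S a∉S′ e = ⊆-antisym (⊆-from e a∉S) (⊆-from (sym e) a∉S′)
  where
    ⊆-from : ∀ {X Y} → ⁅ a ⁆ ∪ X ≡ ⁅ a ⁆ ∪ Y → ¬ a ∈ X → ∀ {j} → j ∈ X → j ∈ Y
    ⊆-from {X} {Y} e a∉X {j} j∈X with x∈p∪q⁻ ⁅ a ⁆ Y (subst (j ∈_) e (x∈p∪q⁺ (inj₂ j∈X)))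
    ... | inj₁ j∈⁅a⁆ rewrite x∈⁅y⁆⇒x≡y a j∈⁅a⁆ = ⊥-elim (a∉X j∈X)
    ... | inj₂ j∈Y = j∈Y

∈-cleared⁻ : ∀ {n} {a j : Fin n} (P : Subset n) → j ∈ P [ a ]≔ false → j ≢ a × j ∈ P
∈-cleared⁻ {a = zero} (_ ∷ P) (there j∈P) = (λ ()) , there j∈P
∈-cleared⁻ {a = suc a} (_ ∷ P) here = (λ ()) , here
∈-cleared⁻ {a = suc a} (_ ∷ P) (there j∈P) =
  let j≢a , j∈P = ∈-cleared⁻ P j∈P in (λ e → j≢a (FinP.suc-injective e)) , there j∈P

∪-cleared : ∀ {n} {a : Fin n} (P S : Subset n) → a ∈ P → P ∪ S ≡ (P [ a ]≔ false) ∪ (⁅ a ⁆ ∪ S)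
∪-cleared (true ∷ P) (_ ∷ S) here = cong (true ∷_) (cong (P ∪_) (sym (∪-identityˡ S)))
∪-cleared (c ∷ P) (d ∷ S) (there a∈P) = cong (_ ∷_) (∪-cleared P S a∈P)

Above Below : ∀ {n} → ℕ → Subset n → Set
Above k S = ∀ {j} → j ∈ S → k ≤ toℕ j
Below k P = ∀ {j} → j ∈ P → toℕ j < k

Above-weaken : ∀ {n k} {S : Subset n} → Above (suc k) S → Above k S
Above-weaken above = ℕ.<⇒≤ ∘ above

Above-⁅⁆∪ : ∀ {n k} {a : Fin n} {S} → toℕ a ≡ k → Above (suc k) S → Above k (⁅ a ⁆ ∪ S)
Above-⁅⁆∪ {a = a} {S} a≡k above j∈ with x∈p∪q⁻ ⁅ a ⁆ S j∈
... | inj₁ j∈⁅a⁆ rewrite x∈⁅y⁆⇒x≡y a j∈⁅a⁆ = ℕ.≤-reflexive (sym a≡k)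
... | inj₂ j∈S = Above-weaken above j∈S

Above-∅-++ : ∀ {a b} {S : Subset b} → Above a (∅ {a} ++ S)
Above-∅-++ {zero} _ = z≤n
Above-∅-++ {suc a} (there j∈) = s≤s (Above-∅-++ j∈)

Above-∅-++⁺ : ∀ {a b k} {S : Subset b} → Above k S → Above (a + k) (∅ {a} ++ S)
Above-∅-++⁺ {zero} above = above
Above-∅-++⁺ {suc a} above (there j∈) = s≤s (Above-∅-++⁺ {a} above j∈)

Below-++-∅ : ∀ {a b} (P : Subset a) → Below a (P ++ ∅ {b})
Below-++-∅ [] j∈∅ = ⊥-elim (∉⊥ j∈∅)
Below-++-∅ (_ ∷ P) here = s≤s z≤n
Below-++-∅ (_ ∷ P) (there j∈) = s≤s (Below-++-∅ P j∈)

Below-++⁺ : ∀ {a b k} (P : Subset a) {Q : Subset b} → Below k Q → Below (a + k) (P ++ Q)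
Below-++⁺ [] below = below
Below-++⁺ (_ ∷ P) below here = s≤s z≤n
Below-++⁺ (_ ∷ P) below (there j∈) = s≤s (Below-++⁺ P below j∈)

module Residual {n : ℕ} (D : ZDD n) where
  open ZDD D

  LabelledFrom : ℕ → Target N → Set
  LabelledFrom k (node i) = k ≤ toℕ (lb i)
  LabelledFrom k _ = ⊤

  child-labelled : ∀ i {t} → (∀ j → t ≡ node j → lb i Fin.< lb j) → LabelledFrom (suc (toℕ (lb i))) t
  child-labelled i {top} _ = tt
  child-labelled i {bot} _ = tt
  child-labelled i {node j} ordered = ordered j refl

  Mem-above : ∀ {k t T} → Mem D t T → LabelledFrom k t → Above k T
  Mem-above mem-top _ j∈∅ = ⊥-elim (∉⊥ j∈∅)
  Mem-above (mem-lo i S p) k≤i j∈S =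
    ℕ.≤-trans k≤i (ℕ.<⇒≤ (Mem-above p (child-labelled i (lo-ordered i)) j∈S))
  Mem-above (mem-hi i S p) k≤i j∈T with x∈p∪q⁻ ⁅ lb i ⁆ S j∈T
  ... | inj₁ j∈⁅i⁆ rewrite x∈⁅y⁆⇒x≡y (lb i) j∈⁅i⁆ = k≤i
  ... | inj₂ j∈S = ℕ.≤-trans k≤i (ℕ.<⇒≤ (Mem-above p (child-labelled i (hi-ordered i)) j∈S))

  ∉-Mem : ∀ {a t T} → Mem D t T → LabelledFrom (suc (toℕ a)) t → ¬ a ∈ T
  ∉-Mem p labelled a∈T = ℕ.<-irrefl refl (Mem-above p labelled a∈T)

  lo-step : ∀ i S → Above (suc (toℕ (lb i))) S → Mem D (node i) S ⇔ Mem D (lo i) S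
  lo-step i S above = mk⇔ node→lo (mem-lo i S)
    where
      node→lo : Mem D (node i) S → Mem D (lo i) S
      node→lo (mem-lo _ _ p) = p
      node→lo (mem-hi _ _ _) = ⊥-elim (ℕ.<-irrefl refl (above (x∈p∪q⁺ (inj₁ (x∈⁅x⁆ (lb i))))))

  hi-step : ∀ i S → Above (suc (toℕ (lb i))) S → Mem D (node i) (⁅ lb i ⁆ ∪ S) ⇔ Mem D (hi i) S
  hi-step i S above = mk⇔ (λ p → node→hi p refl) (mem-hi i S)
    where
      lb∈ : ∀ X → lb i ∈ ⁅ lb i ⁆ ∪ X
      lb∈ X = x∈p∪q⁺ (inj₁ (x∈⁅x⁆ (lb i)))
      node→hi : ∀ {T} → Mem D (node i) T → T ≡ ⁅ lb i ⁆ ∪ S → Mem D (hi i) S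
      node→hi (mem-lo _ _ p) refl = ⊥-elim (∉-Mem p (child-labelled i (lo-ordered i)) (lb∈ S))
      node→hi (mem-hi _ S′ p) e =
        subst (Mem D (hi i))
              (∪-cancelˡ-⁅⁆ (∉-Mem p (child-labelled i (hi-ordered i))) (ℕ.<-irrefl refl ∘ above) e) p

  labelled-from-0 : ∀ t → LabelledFrom 0 t
  labelled-from-0 top = tt
  labelled-from-0 bot = tt
  labelled-from-0 (node i) = z≤n

  -- t′ is where t leads once the element at position k has been decided (f adds it or not).
  Stepped : ℕ → Target N → (Subset n → Subset n) → Set
  Stepped k t f = ∃ λ t′ → LabelledFrom (suc k) t′ × (∀ S → Above (suc k) S → Mem D t (f S) ⇔ Mem D t′ S)

  labelled-view : ∀ {a} t → LabelledFrom (toℕ a) t →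
                  LabelledFrom (suc (toℕ a)) t ⊎ ∃ λ i → t ≡ node i × lb i ≡ a
  labelled-view top _ = inj₁ tt
  labelled-view bot _ = inj₁ tt
  labelled-view (node i) a≤i with ℕ.m≤n⇒m<n∨m≡n a≤i
  ... | inj₁ a<i = inj₁ a<i
  ... | inj₂ a≡i = inj₂ (i , refl , FinP.toℕ-injective (sym a≡i))

  step-out : ∀ {k} (a : Fin n) t → toℕ a ≡ k → LabelledFrom k t → Stepped k t (λ S → S)
  step-out a t refl labelled with labelled-view t labelled
  ... | inj₁ labelled′ = t , labelled′ , λ S _ → ⇔.refl
  ... | inj₂ (i , refl , refl) = lo i , child-labelled i (lo-ordered i) , lo-step i

  step-in : ∀ {k} (a : Fin n) t → toℕ a ≡ k → LabelledFrom k t → Stepped k t (⁅ a ⁆ ∪_)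
  step-in a t refl labelled with labelled-view t labelled
  ... | inj₁ labelled′ = bot , tt , λ S _ →
        mk⇔ (λ p → ⊥-elim (∉-Mem p labelled′ (x∈p∪q⁺ (inj₁ (x∈⁅x⁆ a))))) (λ ())
  ... | inj₂ (i , refl , refl) = hi i , child-labelled i (hi-ordered i) , hi-step i

  residual : ∀ k → k ≤ n → (P : Subset n) → Below k P →
             ∃ λ t → LabelledFrom k t × (∀ S → Above k S → Mem D root (P ∪ S) ⇔ Mem D t S)
  residual zero _ P below rewrite Empty-unique (λ (_ , j∈P) → ℕ.n≮0 (below j∈P)) =
    root , labelled-from-0 root ,
    λ S _ → subst (λ X → Mem D root X ⇔ Mem D root S) (sym (∪-identityˡ S)) ⇔.refl
  residual (suc k) k<n P below = decide (a ∈? P)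
    where
      a : Fin n
      a = Fin.fromℕ< k<n
      a≡k : toℕ a ≡ k
      a≡k = FinP.toℕ-fromℕ< k<n
      below-k : ∀ {X} → (∀ {j} → j ∈ X → j ≢ a × j ∈ P) → Below k X
      below-k sub j∈X with sub j∈X
      ... | j≢a , j∈P = ℕ.≤∧≢⇒< (s≤s⁻¹ (below j∈P)) (λ j≡k → j≢a (FinP.toℕ-injective (trans j≡k (sym a≡k))))
      decide : Dec (a ∈ P) →
               ∃ λ t → LabelledFrom (suc k) t × (∀ S → Above (suc k) S → Mem D root (P ∪ S) ⇔ Mem D t S)
      decide (no a∉P) with residual k (ℕ.<⇒≤ k<n) P (below-k (λ j∈P → (λ { refl → a∉P j∈P }) , j∈P))
      ... | t₀ , labelled₀ , rest₀ with step-out a t₀ a≡k labelled₀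
      ... | t₁ , labelled₁ , step =
            t₁ , labelled₁ , λ S above → ⇔.trans (rest₀ S (Above-weaken above)) (step S above)
      decide (yes a∈P) with residual k (ℕ.<⇒≤ k<n) (P [ a ]≔ false) (below-k (∈-cleared⁻ P))
      ... | t₀ , labelled₀ , rest₀ with step-in a t₀ a≡k labelled₀
      ... | t₁ , labelled₁ , step = t₁ , labelled₁ , λ S above →
            ⇔.trans (subst (λ X → Mem D root X ⇔ Mem D t₀ (⁅ a ⁆ ∪ S)) (sym (∪-cleared P S a∈P))
                           (rest₀ (⁅ a ⁆ ∪ S) (Above-⁅⁆∪ a≡k above)))
                    (step S above)

encodeTarget : ∀ {N} → Target N → Fin (2 + N)
encodeTarget top = zero
encodeTarget bot = suc zero
encodeTarget (node i) = suc (suc i)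

encodeTarget-injective : ∀ {N} {x y : Target N} → encodeTarget x ≡ encodeTarget y → x ≡ y
encodeTarget-injective {x = top} {top} _ = refl
encodeTarget-injective {x = bot} {bot} _ = refl
encodeTarget-injective {x = node i} {node j} e = cong node (FinP.suc-injective (FinP.suc-injective e))

subsetOf : ∀ {m} → Fin (2 ^ m) → Subset m
subsetOf {m} i = tabulate (Inverse.to FinP.2↔Bool ∘ Fin.finToFun {2} {m} i)

funToFin-cong : ∀ {m n} {f g : Fin m → Fin n} → (∀ i → f i ≡ g i) → Fin.funToFin f ≡ Fin.funToFin g
funToFin-cong {zero} _ = refl
funToFin-cong {suc m} f≗g = cong₂ Fin.combine (f≗g zero) (funToFin-cong (f≗g ∘ suc))

subsetOf-injective : ∀ {m} {i j : Fin (2 ^ m)} → subsetOf i ≡ subsetOf j → i ≡ j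
subsetOf-injective {m} {i} {j} e = begin
  i                                        ≡⟨ FinP.funToFin-finToFin {m} {2} i ⟨
  Fin.funToFin (Fin.finToFun {2} {m} i)  ≡⟨ funToFin-cong same-bits ⟩
  Fin.funToFin (Fin.finToFun {2} {m} j)  ≡⟨ FinP.funToFin-finToFin {m} {2} j ⟩
  j                                        ∎
  where
    open ≡-Reasoning
    same-bits : ∀ k → Fin.finToFun {2} {m} i k ≡ Fin.finToFun j k
    same-bits k = Injection.injective (↔⇒↣ FinP.2↔Bool)
      (trans (sym (lookup∘tabulate _ k)) (trans (cong (λ S → lookup S k) e) (lookup∘tabulate _ k)))

2^≤-injection : ∀ {m N} (f : Subset m → Target N) → (∀ {x y} → f x ≡ f y → x ≡ y) → 2 ^ m ≤ N + 2
2^≤-injection {m} {N} f injective = subst (2 ^ m ≤_) (ℕ.+-comm 2 N) (FinP.injective⇒≤ {f = g} g-injective)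
  where
    g : Fin (2 ^ m) → Fin (2 + N)
    g = encodeTarget ∘ f ∘ subsetOf
    g-injective : ∀ {i j} → g i ≡ g j → i ≡ j
    g-injective = subsetOf-injective ∘ injective ∘ encodeTarget-injective

-- Prefixes pre ++ x with different suffix languages lead to different nodes at level a + b.
fooling-bound : ∀ {a b c} (D : ZDD (a + (b + c))) {H : Fam (a + (b + c))} → Represents D H →
  (pre : Subset a) → (∀ x y → (∀ s → H (pre ++ (x ++ s)) ⇔ H (pre ++ (y ++ s))) → x ≡ y) → 2 ^ b ≤ size D
fooling-bound {a} {b} {c} D {H} rep pre separating = 2^≤-injection target target-injective
  where
    open Residual D
    suffix : Subset c → Subset (a + (b + c))
    suffix s = ∅ {a} ++ (∅ {b} ++ s)
    split : ∀ x s → (pre ++ (x ++ ∅)) ∪ suffix s ≡ pre ++ (x ++ s)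
    split x s = begin
      (pre ++ (x ++ ∅)) ∪ (∅ {a} ++ (∅ {b} ++ s))  ≡⟨ zipWith-++ _ pre _ ∅ _ ⟩
      (pre ∪ ∅) ++ ((x ++ ∅) ∪ (∅ ++ s))   ≡⟨ cong₂ _++_ (∪-identityʳ pre) (zipWith-++ _ x ∅ ∅ s) ⟩
      pre ++ ((x ∪ ∅) ++ (∅ ∪ s))          ≡⟨ cong₂ (λ u v → pre ++ (u ++ v)) (∪-identityʳ x) (∪-identityˡ s) ⟩
      pre ++ (x ++ s)                        ∎
      where open ≡-Reasoning
    R : ∀ x → ∃ λ t → LabelledFrom (a + b) t ×
                (∀ S → Above (a + b) S → Mem D (ZDD.root D) ((pre ++ (x ++ ∅)) ∪ S) ⇔ Mem D t S)
    R x = residual (a + b) (ℕ.+-monoʳ-≤ a (ℕ.m≤m+n b c)) (pre ++ (x ++ ∅)) (Below-++⁺ pre (Below-++-∅ x))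
    target : Subset b → Target (ZDD.N D)
    target x = proj₁ (R x)
    language : ∀ x s → Mem D (target x) (suffix s) ⇔ H (pre ++ (x ++ s))
    language x s = ⇔.trans (⇔.sym (proj₂ (proj₂ (R x)) (suffix s) (Above-∅-++⁺ {a} (Above-∅-++ {b}))))
                           (subst (λ X → Mem D (ZDD.root D) X ⇔ H (pre ++ (x ++ s))) (sym (split x s))
                                  (Represents⇒RepresentsAt rep _))
    target-injective : ∀ {x y} → target x ≡ target y → x ≡ y
    target-injective {x} {y} e = separating x y λ s →
      ⇔.trans (⇔.sym (language x s))
              (subst (λ t → Mem D t (suffix s) ⇔ H (pre ++ (y ++ s))) (sym e) (language y s))

-- The hard instance

cubic-bound : ∀ m → 1 ≤ m → (suc m + (m + m) * ∣Query∣ m m + 2) + (suc m + 0 + 2) ≤ 18 * m ^ 3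
cubic-bound (suc k) _ =
  ℕ.≤-trans (ℕ.m≤m+n _ (16 * (k * k * k) + 44 * (k * k) + 34 * k)) (ℕ.≤-reflexive (polynomial k))
  where
    polynomial : ∀ k →
      (suc (suc k) + (suc k + suc k) * (2 + (suc k + suc k + suc k * suc k)) + 2) + (suc (suc k) + 0 + 2)
        + (16 * (k * k * k) + 44 * (k * k) + 34 * k) ≡ 18 * (suc k * (suc k * (suc k * 1)))
    polynomial = solve-∀

module Instance (m : ℕ) where

  ground : ℕ
  ground = suc m + (m + m)

  test : Fin (suc m) → Query m m
  test zero = all
  test (suc i) = eq i i

  F G : Fam ground
  F = chain (suc m) (⟦_⟧ ∘ test)
  G = chain (suc m) (λ _ → onlyEmpty)

  test-++ : ∀ i (x y : Subset m) → ⟦ test (suc i) ⟧ (x ++ y) ≡ (lookup y i ≡ lookup x i)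
  test-++ i x y rewrite proj₁ (take-drop-++ x y) | proj₂ (take-drop-++ x y) = refl

  G-⁅⁆ : ∀ (i : Fin (suc m)) → G (⁅ i ⁆ ++ ∅)
  G-⁅⁆ i = from (chain-⁅⁆-++ (suc m) (λ _ → onlyEmpty) i ∅) refl

  G⁻ : ∀ {A} → G A → ∃ λ i → A ≡ ⁅ i ⁆ ++ ∅
  G⁻ {A} g with chain⁻ (suc m) (λ _ → onlyEmpty) A g
  ... | i , v , A≡ , refl = i , A≡

  ⁅⁆-++-∪ : ∀ (i : Fin (suc m)) (v : Subset (m + m)) → (⁅ i ⁆ ++ ∅) ∪ (∅ {suc m} ++ v) ≡ ⁅ i ⁆ ++ v
  ⁅⁆-++-∪ i v = trans (zipWith-++ _ ⁅ i ⁆ ∅ ∅ v) (cong₂ _++_ (∪-identityʳ ⁅ i ⁆) (∪-identityˡ v))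

  ∪-⁅⁆-++ : ∀ (i : Fin (suc m)) (v : Subset (m + m)) → (∅ {suc m} ++ v) ∪ (⁅ i ⁆ ++ ∅) ≡ ⁅ i ⁆ ++ v
  ∪-⁅⁆-++ i v = trans (∪-comm (∅ {suc m} ++ v) (⁅ i ⁆ ++ ∅)) (⁅⁆-++-∪ i v)

  diagonal∈÷ : ∀ x → (F ÷ G) (∅ {suc m} ++ (x ++ x))
  diagonal∈÷ x B g with G⁻ {B} g
  ... | i , refl =
    subst F (sym (∪-⁅⁆-++ i (x ++ x))) (from (chain-⁅⁆-++ (suc m) (⟦_⟧ ∘ test) i (x ++ x)) (passes i)) , disjoint
    where
      passes : ∀ i → ⟦ test i ⟧ (x ++ x)
      passes zero = tt
      passes (suc i) rewrite test-++ i x x = refl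
      disjoint : (∅ {suc m} ++ (x ++ x)) ∩ (⁅ i ⁆ ++ ∅) ≡ ∅
      disjoint = trans (zipWith-++ _ ∅ (x ++ x) ⁅ i ⁆ ∅)
                       (trans (cong₂ _++_ (∩-zeroˡ ⁅ i ⁆) (∩-zeroʳ (x ++ x))) (∅-++-∅ (suc m)))

  ÷-avoids-z : ∀ {z} {v : Subset (m + m)} → (F ÷ G) (z ++ v) → z ≡ ∅
  ÷-avoids-z {z} {v} h = Empty-unique λ (i , i∈z) → ∉⊥ (subst (i ∈_) (z∩⁅i⁆≡∅ i) (x∈p∩q⁺ (i∈z , x∈⁅x⁆ i)))
    where
      z∩⁅i⁆≡∅ : ∀ i → z ∩ ⁅ i ⁆ ≡ ∅
      z∩⁅i⁆≡∅ i = ++-injectiveˡ (z ∩ ⁅ i ⁆) ∅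
        (trans (sym (zipWith-++ _ z v ⁅ i ⁆ ∅)) (trans (proj₂ (h _ (G-⁅⁆ i))) (sym (∅-++-∅ (suc m)))))

  ÷-passes : ∀ {v} → (F ÷ G) (∅ {suc m} ++ v) → ∀ i → ⟦ test i ⟧ v
  ÷-passes {v} h i =
    to (chain-⁅⁆-++ (suc m) (⟦_⟧ ∘ test) i v) (subst F (∪-⁅⁆-++ i v) (proj₁ (h (⁅ i ⁆ ++ ∅) (G-⁅⁆ i))))

  ÷-diagonal : ∀ {S} → (F ÷ G) S → ∃ λ (x : Subset m) → S ≡ ∅ {suc m} ++ (x ++ x)
  ÷-diagonal {S} h with Vec.splitAt (suc m) S
  ... | z , v , refl with Vec.splitAt m v | ÷-avoids-z {z} {v} h
  ... | x , y , refl | refl = x , cong (λ y → ∅ {suc m} ++ (x ++ y)) (sym x≡y)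
    where
      same : ∀ i → lookup x i ≡ lookup y i
      same i = sym (subst (λ P → P) (test-++ i x y) (÷-passes h (suc i)))
      x≡y : x ≡ y
      x≡y = trans (sym (tabulate∘lookup x)) (trans (tabulate-cong same) (tabulate∘lookup y))

  diagonal∉mod : ∀ x → ¬ (F mod G) (⁅ zero {m} ⁆ ++ (x ++ x))
  diagonal∉mod x (_ , ∉join) = ∉join (_ , _ , G-⁅⁆ zero , diagonal∈÷ x , sym (⁅⁆-++-∪ zero (x ++ x)))

  off-diagonal∈mod : ∀ {x y} → x ≢ y → (F mod G) (⁅ zero {m} ⁆ ++ (x ++ y))
  off-diagonal∈mod {x} {y} x≢y = from (chain-⁅⁆-++ (suc m) (⟦_⟧ ∘ test) zero (x ++ y)) tt , ∉join
    where
      ∉join : ¬ (G ⊔ (F ÷ G)) (⁅ zero {m} ⁆ ++ (x ++ y))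
      ∉join (A , B , g , q , e) with G⁻ {A} g | ÷-diagonal {B} q
      ... | i , refl | w , refl =
        let x≡w , y≡w = ++-injective x w (++-injectiveʳ ⁅ zero {m} ⁆ ⁅ i ⁆ (trans e (⁅⁆-++-∪ i (w ++ w))))
        in x≢y (trans x≡w (sym y≡w))

  prefix : Op → Subset (suc m)
  prefix quot = ∅
  prefix rem = ⁅ zero ⁆

  separating : ∀ op (x y : Subset m) →
               (∀ s → apply op F G (prefix op ++ (x ++ s)) ⇔ apply op F G (prefix op ++ (y ++ s))) → x ≡ y
  separating quot x y same with ÷-diagonal (to (same x) (diagonal∈÷ x))
  ... | w , e = let y≡w , x≡w = ++-injective y w (++-injectiveʳ (∅ {suc m}) ∅ e) in trans x≡w (sym y≡w)
  separating rem x y same with ≡-dec Bool._≟_ x y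
  ... | yes x≡y = x≡y
  ... | no x≢y = ⊥-elim (diagonal∉mod x (from (same x) (off-diagonal∈mod (x≢y ∘ sym))))

  lower-bound : ∀ op (D : ZDD ground) → Represents D (apply op F G) → 2 ^ m ≤ size D
  lower-bound op D rep = fooling-bound {suc m} {m} {m} D rep (prefix op) (separating op)

  private
    X : Shared (m + m) (Query m m) ⟦_⟧
    X = x-stage m m
    CF : ChainZDD (Shared.zdd X) (suc m) (⟦_⟧ ∘ test)
    CF = chainZDD _ (suc m) (Shared.target X ∘ test) (Shared.represents X ∘ test)
    CG : ChainZDD (emptyZDD (m + m)) (suc m) (λ _ → onlyEmpty)
    CG = chainZDD _ (suc m) (λ _ → top) (λ _ → top-represents)

  DF DG : ZDD ground
  DF = rerooted (ChainZDD.zdd CF) (ChainZDD.root CF)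
  DG = rerooted (ChainZDD.zdd CG) (ChainZDD.root CG)

  DF-represents : Represents DF F
  DF-represents = rerooted-represents _ _ (ChainZDD.root-represents CF)

  DG-represents : Represents DG G
  DG-represents = rerooted-represents _ _ (ChainZDD.root-represents CG)

  size-bound : 1 ≤ m → size DF + size DG ≤ 18 * m ^ 3
  size-bound 1≤m = begin
    size DF + size DG
      ≡⟨ cong₂ (λ a b → (a + 2) + (b + 2)) (ChainZDD.nodes≡ CF) (ChainZDD.nodes≡ CG) ⟩
    (suc m + nodes X + 2) + (suc m + 0 + 2)
      ≤⟨ ℕ.+-monoˡ-≤ _ (ℕ.+-monoˡ-≤ 2 (ℕ.+-monoʳ-≤ (suc m) (x-stage-nodes m m ℕ.≤-refl))) ⟩
    (suc m + (m + m) * ∣Query∣ m m + 2) + (suc m + 0 + 2)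
      ≤⟨ cubic-bound m 1≤m ⟩
    18 * m ^ 3 ∎
    where open ℕ.≤-Reasoning

ground-bound : ∀ m → 1 ≤ m → Instance.ground m ≤ 4 * m
ground-bound (suc k) _ = ℕ.≤-trans (ℕ.m≤m+n _ k) (ℕ.≤-reflexive (polynomial k))
  where
    polynomial : ∀ k → (suc (suc k) + (suc k + suc k)) + k ≡ 4 * suc k
    polynomial = solve-∀

size≤size^5 : ∀ {n} (D : ZDD n) → size D ≤ size D ^ 5
size≤size^5 D rewrite ℕ.+-comm (ZDD.N D) 2 =
  ℕ.m≤m*n (2 + ZDD.N D) ((2 + ZDD.N D) ^ 4) {{ℕ.m^n≢0 (2 + ZDD.N D) 4}}

theorem9 : (op : Op) →
    Σ (ℕ → ℕ) λ u →
    Σ ((m : ℕ) → Fam (u m)) λ F →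
    Σ ((m : ℕ) → Fam (u m)) λ G →
      (∃₂ λ c m₀ → ∀ m → m₀ ≤ m → u m ≤ c * m)
      × (∃₂ λ c m₀ → ∀ m → m₀ ≤ m →
           Σ (ZDD (u m)) λ DF → Σ (ZDD (u m)) λ DG →
             Represents DF (F m) × Represents DG (G m) × size DF + size DG ≤ c * m ^ 3)
      × (∃₂ λ c d → ∃ λ m₀ → ∀ m → m₀ ≤ m →
           (D : ZDD (u m)) → Represents D (apply op (F m) (G m)) →
             2 ^ m ≤ (c * m ^ d * size D) ^ 5)
theorem9 op = Instance.ground , Instance.F , Instance.G
  , (4 , 1 , ground-bound)
  , (18 , 1 , λ m 1≤m → Instance.DF m , Instance.DG m
                       , Instance.DF-represents m , Instance.DG-represents m , Instance.size-bound m 1≤m)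
  , (1 , 0 , 0 , λ m _ D rep → begin
       2 ^ m                  ≤⟨ Instance.lower-bound m op D rep ⟩
       size D                 ≤⟨ size≤size^5 D ⟩
       size D ^ 5             ≡⟨ cong (_^ 5) (ℕ.*-identityˡ (size D)) ⟨
       (1 * m ^ 0 * size D) ^ 5 ∎)
  where open ℕ.≤-Reasoning
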